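{- Let $\mathbf{q}\in\mathbb{Z}_{\geq2}^n$. For every integer $m\geq2$, the simplex $\Delta_{(1,\mathrm{rs}(\mathbf{q},m))}$ is not IDP.
   Context: For a weakly increasing $\mathbf{p}=(p_1,\ldots,p_N)\in\mathbb{Z}_{\geq1}^N$, $\Delta_{(1,\mathbf{p})}:=\mathrm{conv}\{\mathbf{e}_1,\ldots,\mathbf{e}_N,-\sum_i p_i\mathbf{e}_i\}\subset\mathbb{R}^N$; it is reflexive iff each $p_i$ divides $1+\sum_j p_j$. For $\mathbf{q}\in\mathbb{Z}_{\geq1}^n$, $\mathrm{rsn}(\mathbf{q})$ is the least $k\ge0$ such that $\Delta_{(1,(1^k,\mathbf{q}))}$ is reflexive ($(1^k,\mathbf{q})$ is $\mathbf{q}$ with $k$ ones prepended), and $\mathrm{rs}(\mathbf{q},m):=(1^{\mathrm{rsn}(\mathbf{q})+(m-1)\mathrm{lcm}(\mathbf{q})},\mathbf{q})$. For a lattice polytope $P\subset\mathbb{R}^N$, $\mathrm{cone}(P)$ is the nonnegative span of $(1,\mathbf{v})$ over vertices $\mathbf{v}$; $P$ is IDP if for every positive integer $m$ and every $(m,\mathbf{w})\in\mathrm{cone}(P)\cap\mathbb{Z}^{N+1}$ there are $\mathbf{x}_1,\ldots,\mathbf{x}_m\in P\cap\mathbb{Z}^N$ with $(m,\mathbf{w})=\sum_i(1,\mathbf{x}_i)$. -}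

module Defs where

open import Data.Nat as ℕ using (ℕ; zero; suc; _∸_)
open import Data.Nat.Divisibility using (_∣_)
open import Data.Nat.LCM using (lcm)
open import Data.Fin as Fin using (Fin)
open import Data.Integer as ℤ using (ℤ)
open import Data.Rational as ℚ using (ℚ; 0ℚ; 1ℚ)
open import Data.Vec.Functional using (Vector; _++_; replicate)
open import Data.Product using (Σ; _×_)
open import Relation.Binary.PropositionalEquality using (_≡_)
open import Relation.Nullary using (¬_; yes; no)

Σℕ : ∀ {n} → (Fin n → ℕ) → ℕ
Σℕ {zero}  f = 0
Σℕ {suc n} f = f Fin.zero ℕ.+ Σℕ (λ i → f (Fin.suc i))

Σℤ : ∀ {n} → (Fin n → ℤ) → ℤ
Σℤ {zero}  f = ℤ.+ 0
Σℤ {suc n} f = f Fin.zero ℤ.+ Σℤ (λ i → f (Fin.suc i))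

Σℚ : ∀ {n} → (Fin n → ℚ) → ℚ
Σℚ {zero}  f = 0ℚ
Σℚ {suc n} f = f Fin.zero ℚ.+ Σℚ (λ i → f (Fin.suc i))

lcmV : ∀ {n} → (Fin n → ℕ) → ℕ
lcmV {zero}  f = 1
lcmV {suc n} f = lcm (f Fin.zero) (lcmV (λ i → f (Fin.suc i)))

toℚ : ℤ → ℚ
toℚ z = z ℚ./ 1

Point : ℕ → Set
Point N = Fin N → ℤ

-- A lattice polytope given by a finite list of (vertex) points V 0 .. V (r-1).
-- x ∈ conv(V): nonnegative coefficients summing to 1.
InConv : ∀ {N r} → (Fin r → Point N) → Point N → Set
InConv {N} {r} V x =
  Σ (Fin r → ℚ) λ c →
    (∀ i → 0ℚ ℚ.≤ c i) ×
    (Σℚ c ≡ 1ℚ) ×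
    (∀ j → Σℚ (λ i → c i ℚ.* toℚ (V i j)) ≡ toℚ (x j))

-- (m , w) ∈ cone(P) = nonnegative span of the (1 , v), v vertex.
InCone : ∀ {N r} → (Fin r → Point N) → ℤ → Point N → Set
InCone {N} {r} V m w =
  Σ (Fin r → ℚ) λ c →
    (∀ i → 0ℚ ℚ.≤ c i) ×
    (Σℚ c ≡ toℚ m) ×
    (∀ j → Σℚ (λ i → c i ℚ.* toℚ (V i j)) ≡ toℚ (w j))

IDP : ∀ {N r} → (Fin r → Point N) → Set
IDP {N} V =
  (m : ℕ) → 1 ℕ.≤ m → (w : Point N) → InCone V (ℤ.+ m) w →
  Σ (Fin m → Point N) λ xs →
    (∀ i → InConv V (xs i)) ×
    (∀ j → Σℤ (λ i → xs i j) ≡ w j)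

e : ∀ {N} → Fin N → Point N
e i j with i Fin.≟ j
... | yes _ = ℤ.+ 1
... | no  _ = ℤ.+ 0

-- vertices of Δ_(1,p): e_1, …, e_N and -Σ p_i e_i
Δ-vertices : ∀ {N} → (Fin N → ℕ) → Fin (suc N) → Point N
Δ-vertices p Fin.zero    j = ℤ.- (ℤ.+ p j)
Δ-vertices p (Fin.suc i) = e i

WeaklyIncreasing : ∀ {N} → (Fin N → ℕ) → Set
WeaklyIncreasing {N} p = ∀ i j → i Fin.≤ j → p i ℕ.≤ p j

-- reflexivity criterion for Δ_(1,p): each p_i divides 1 + Σ_j p_j
ReflexiveΔ : ∀ {N} → (Fin N → ℕ) → Set
ReflexiveΔ p = ∀ i → p i ∣ suc (Σℕ p)

ones++ : ∀ {n} → (k : ℕ) → (Fin n → ℕ) → Fin (k ℕ.+ n) → ℕ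
ones++ k q = replicate k 1 ++ q

IsRsn : ∀ {n} → (Fin n → ℕ) → ℕ → Set
IsRsn q k = ReflexiveΔ (ones++ k q) × (∀ k′ → k′ ℕ.< k → ¬ ReflexiveΔ (ones++ k′ q))

-- rs(q,m) given k = rsn(q)
rs : ∀ {n} → (q : Fin n → ℕ) → (k m : ℕ) → Fin ((k ℕ.+ (m ∸ 1) ℕ.* lcmV q) ℕ.+ n) → ℕ
rs q k m = ones++ (k ℕ.+ (m ∸ 1) ℕ.* lcmV q) q

{-# OPTIONS --safe #-}
-- Write rs(q,m) = (1^K, q); for m ≥ 2 we have K ≥ lcm(q) ≥ max q.  Multiplying barycentric
-- coordinates in Δ_(1,p) by the normalised volume vol = 1 + Σ p makes them integral linear
-- functions of the point.  The point (N, (1 - p_j)_j) lies in the cone, with apex weight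
-- Σ p < vol.  If it were a sum of N lattice points of Δ_(1,p), their apex weights would add
-- up to Σ p, so none of them is the apex -p.  Since K ≥ max q, every other lattice point of
-- Δ_(1,p) has nonnegative coordinates; but the coordinate 1 - q_j of the witness is negative.
module Submission where

open import Defs
open import Data.Nat using (ℕ; _≤_)
open import Data.Fin using (Fin)
open import Relation.Nullary using (¬_)

open import Data.Nat as ℕ using (zero; suc; _∸_; NonZero)
import Data.Nat.Properties as ℕP
open import Data.Nat.Divisibility using (_∣_; ∣-trans; ∣⇒≤)
open import Data.Nat.GCD using (gcd)
open import Data.Nat.LCM using (lcm; m∣lcm[m,n]; n∣lcm[m,n]; gcd*lcm)
open import Data.Nat.Coprimality using (1-coprimeTo) renaming (sym to sym-coprime)
open import Data.Integer as ℤ using (ℤ; +_; -[1+_]; _+_; _-_; -_; _*_)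
import Data.Integer.Properties as ℤP
open import Data.Integer.Tactic.RingSolver using (solve-∀)
open import Data.Rational as ℚ using (ℚ; 0ℚ; 1ℚ; mkℚ)
import Data.Rational.Properties as ℚP
open import Data.Rational.Solver using (module +-*-Solver)
import Data.Rational.Unnormalised as ℚᵘ
import Data.Rational.Unnormalised.Properties as ℚᵘP
open import Data.Fin as Fin using (zero; suc; _↑ˡ_; _↑ʳ_)
import Data.Fin.Properties as FinP
open import Data.Vec.Functional using (replicate)
open import Data.Vec.Functional.Properties using (lookup-++ˡ; lookup-++ʳ)
open import Data.Product using (_×_; _,_; proj₁; proj₂)
open import Data.Empty using (⊥-elim)
open import Relation.Nullary using (yes; no)
open import Relation.Binary.PropositionalEquality

toℚᵘ-toℚ : ∀ z → ℚ.toℚᵘ (toℚ z) ≡ ℚᵘ.mkℚᵘ z 0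
toℚᵘ-toℚ z = cong ℚ.toℚᵘ (ℚP.↥p/↧p≡p (mkℚ z 0 (sym-coprime (1-coprimeTo _))))

toℚ-+ : ∀ a b → toℚ (a + b) ≡ toℚ a ℚ.+ toℚ b
toℚ-+ a b = ℚP.toℚᵘ-injective (begin
  ℚ.toℚᵘ (toℚ (a + b))                   ≡⟨ toℚᵘ-toℚ (a + b) ⟩
  ℚᵘ.mkℚᵘ (a + b) 0                      ≈⟨ ℚᵘ.*≡* (cong (_* + 1) (sym (cong₂ _+_ (ℤP.*-identityʳ a) (ℤP.*-identityʳ b)))) ⟩
  ℚᵘ.mkℚᵘ a 0 ℚᵘ.+ ℚᵘ.mkℚᵘ b 0           ≡⟨ cong₂ ℚᵘ._+_ (toℚᵘ-toℚ a) (toℚᵘ-toℚ b) ⟨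
  ℚ.toℚᵘ (toℚ a) ℚᵘ.+ ℚ.toℚᵘ (toℚ b)     ≈⟨ ℚP.toℚᵘ-homo-+ (toℚ a) (toℚ b) ⟨
  ℚ.toℚᵘ (toℚ a ℚ.+ toℚ b)               ∎)
  where open ℚᵘP.≃-Reasoning

toℚ-* : ∀ a b → toℚ (a * b) ≡ toℚ a ℚ.* toℚ b
toℚ-* a b = ℚP.toℚᵘ-injective (begin
  ℚ.toℚᵘ (toℚ (a * b))                   ≡⟨ toℚᵘ-toℚ (a * b) ⟩
  ℚᵘ.mkℚᵘ a 0 ℚᵘ.* ℚᵘ.mkℚᵘ b 0           ≡⟨ cong₂ ℚᵘ._*_ (toℚᵘ-toℚ a) (toℚᵘ-toℚ b) ⟨
  ℚ.toℚᵘ (toℚ a) ℚᵘ.* ℚ.toℚᵘ (toℚ b)     ≈⟨ ℚP.toℚᵘ-homo-* (toℚ a) (toℚ b) ⟨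
  ℚ.toℚᵘ (toℚ a ℚ.* toℚ b)               ∎)
  where open ℚᵘP.≃-Reasoning

toℚ-neg : ∀ a → toℚ (- a) ≡ ℚ.- toℚ a
toℚ-neg a = ℚP.toℚᵘ-injective (begin
  ℚ.toℚᵘ (toℚ (- a))                     ≡⟨ toℚᵘ-toℚ (- a) ⟩
  ℚᵘ.- ℚᵘ.mkℚᵘ a 0                       ≡⟨ cong ℚᵘ.-_ (toℚᵘ-toℚ a) ⟨
  ℚᵘ.- ℚ.toℚᵘ (toℚ a)                    ≈⟨ ℚP.toℚᵘ-homo‿- (toℚ a) ⟨
  ℚ.toℚᵘ (ℚ.- toℚ a)                     ∎)
  where open ℚᵘP.≃-Reasoning

toℚ-- : ∀ a b → toℚ (a - b) ≡ toℚ a ℚ.- toℚ b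
toℚ-- a b = trans (toℚ-+ a (- b)) (cong (toℚ a ℚ.+_) (toℚ-neg b))

toℚ-nonNeg : ∀ {z} → + 0 ℤ.≤ z → 0ℚ ℚ.≤ toℚ z
toℚ-nonNeg {+ n} _ = ℚP.nonNegative⁻¹ _ {{ℚP.normalize-nonNeg n 1}}

toℚ-nonNeg⁻¹ : ∀ {z} → 0ℚ ℚ.≤ toℚ z → + 0 ℤ.≤ z
toℚ-nonNeg⁻¹ {z} 0≤z with ℚP.toℚᵘ-mono-≤ 0≤z
... | ℚᵘ.*≤* 0≤z*1 rewrite toℚᵘ-toℚ z = subst (+ 0 ℤ.≤_) (ℤP.*-identityʳ z) 0≤z*1

*-nonNeg : ∀ {a b} → 0ℚ ℚ.≤ a → 0ℚ ℚ.≤ b → 0ℚ ℚ.≤ a ℚ.* b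
*-nonNeg {a} {b} 0≤a 0≤b = ℚP.nonNegative⁻¹ _
  {{ℚP.nonNeg*nonNeg⇒nonNeg a {{ℚ.nonNegative 0≤a}} b {{ℚ.nonNegative 0≤b}}}}

Σℤ-cong : ∀ {n} {f g : Fin n → ℤ} → (∀ i → f i ≡ g i) → Σℤ f ≡ Σℤ g
Σℤ-cong {zero}  f≗g = refl
Σℤ-cong {suc n} f≗g = cong₂ _+_ (f≗g zero) (Σℤ-cong (λ i → f≗g (suc i)))

Σℤ-+ : ∀ {n} (f g : Fin n → ℤ) → Σℤ (λ i → f i + g i) ≡ Σℤ f + Σℤ g
Σℤ-+ {zero}  f g = refl
Σℤ-+ {suc n} f g = trans (cong (_+_ (f zero + g zero)) (Σℤ-+ (λ i → f (suc i)) (λ i → g (suc i))))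
                         (medial (f zero) (g zero) _ _)
  where
  medial : ∀ a b c d → (a + b) + (c + d) ≡ (a + c) + (b + d)
  medial = solve-∀

Σℤ-- : ∀ {n} (f g : Fin n → ℤ) → Σℤ (λ i → f i - g i) ≡ Σℤ f - Σℤ g
Σℤ-- {zero}  f g = refl
Σℤ-- {suc n} f g = trans (cong (_+_ (f zero - g zero)) (Σℤ-- (λ i → f (suc i)) (λ i → g (suc i))))
                         (medial (f zero) (g zero) _ _)
  where
  medial : ∀ a b c d → (a - b) + (c - d) ≡ (a + c) - (b + d)
  medial = solve-∀

Σℤ-*ˡ : ∀ {n} k (f : Fin n → ℤ) → Σℤ (λ i → k * f i) ≡ k * Σℤ f
Σℤ-*ˡ {zero}  k f = sym (ℤP.*-zeroʳ k)
Σℤ-*ˡ {suc n} k f = trans (cong (_+_ (k * f zero)) (Σℤ-*ˡ k (λ i → f (suc i))))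
                          (sym (ℤP.*-distribˡ-+ k (f zero) _))

Σℤ-const : ∀ {n} z → Σℤ {n} (λ _ → z) ≡ + n * z
Σℤ-const {zero}  z = sym (ℤP.*-zeroˡ z)
Σℤ-const {suc n} z = trans (cong (_+_ z) (Σℤ-const {n} z)) (suc-* z (+ n))
  where
  suc-* : ∀ z n → z + n * z ≡ (+ 1 + n) * z
  suc-* = solve-∀

Σℤ-+ℕ : ∀ {n} (f : Fin n → ℕ) → Σℤ (λ i → + f i) ≡ + Σℕ f
Σℤ-+ℕ {zero}  f = refl
Σℤ-+ℕ {suc n} f = cong (_+_ (+ f zero)) (Σℤ-+ℕ (λ i → f (suc i)))

Σℤ-mono-≤ : ∀ {n} {f g : Fin n → ℤ} → (∀ i → f i ℤ.≤ g i) → Σℤ f ℤ.≤ Σℤ g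
Σℤ-mono-≤ {zero}  f≤g = ℤP.≤-refl
Σℤ-mono-≤ {suc n} f≤g = ℤP.+-mono-≤ (f≤g zero) (Σℤ-mono-≤ (λ i → f≤g (suc i)))

Σℤ-nonNeg : ∀ {n} {f : Fin n → ℤ} → (∀ i → + 0 ℤ.≤ f i) → + 0 ℤ.≤ Σℤ f
Σℤ-nonNeg {zero}  0≤f = ℤP.≤-refl
Σℤ-nonNeg {suc n} 0≤f = ℤP.+-mono-≤ (0≤f zero) (Σℤ-nonNeg (λ i → 0≤f (suc i)))

≤-Σℤ : ∀ {n} {f : Fin n → ℤ} → (∀ i → + 0 ℤ.≤ f i) → ∀ j → f j ℤ.≤ Σℤ f
≤-Σℤ {suc n} {f} 0≤f zero    = ℤP.i≤i+j (f zero) _ {{ℤ.nonNegative (Σℤ-nonNeg (λ i → 0≤f (suc i)))}}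
≤-Σℤ {suc n} {f} 0≤f (suc j) = ℤP.i≤j⇒i≤k+j (f zero) {{ℤ.nonNegative (0≤f zero)}} (≤-Σℤ (λ i → 0≤f (suc i)) j)

Σℤ-↑ : ∀ m {n} (f : Fin (m ℕ.+ n) → ℤ) → Σℤ f ≡ Σℤ (λ i → f (i ↑ˡ n)) + Σℤ (λ i → f (m ↑ʳ i))
Σℤ-↑ zero    f = sym (ℤP.+-identityˡ (Σℤ f))
Σℤ-↑ (suc m) f = trans (cong (_+_ (f zero)) (Σℤ-↑ m (λ i → f (suc i)))) (sym (ℤP.+-assoc (f zero) _ _))

Σℤ-comm : ∀ {m n} (x : Fin m → Fin n → ℤ) → Σℤ (λ i → Σℤ (x i)) ≡ Σℤ (λ j → Σℤ (λ i → x i j))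
Σℤ-comm {zero} {n} x = sym (trans (Σℤ-const {n} (+ 0)) (ℤP.*-zeroʳ (+ n)))
Σℤ-comm {suc m} x = trans (cong (_+_ (Σℤ (x zero))) (Σℤ-comm (λ i → x (suc i))))
                          (sym (Σℤ-+ (x zero) (λ j → Σℤ (λ i → x (suc i) j))))

Σℚ-cong : ∀ {n} {f g : Fin n → ℚ} → (∀ i → f i ≡ g i) → Σℚ f ≡ Σℚ g
Σℚ-cong {zero}  f≗g = refl
Σℚ-cong {suc n} f≗g = cong₂ ℚ._+_ (f≗g zero) (Σℚ-cong (λ i → f≗g (suc i)))

Σℚ-toℚ : ∀ {n} (z : Fin n → ℤ) → Σℚ (λ i → toℚ (z i)) ≡ toℚ (Σℤ z)
Σℚ-toℚ {zero}  z = refl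
Σℚ-toℚ {suc n} z = trans (cong (toℚ (z zero) ℚ.+_) (Σℚ-toℚ (λ i → z (suc i)))) (sym (toℚ-+ (z zero) _))

Σℚ-*ʳ : ∀ {n} (f : Fin n → ℚ) k → Σℚ (λ i → f i ℚ.* k) ≡ Σℚ f ℚ.* k
Σℚ-*ʳ {zero}  f k = sym (ℚP.*-zeroˡ k)
Σℚ-*ʳ {suc n} f k = trans (cong (f zero ℚ.* k ℚ.+_) (Σℚ-*ʳ (λ i → f (suc i)) k))
                          (sym (ℚP.*-distribʳ-+ k (f zero) _))

Σℚ-linear : ∀ {n} (f g : Fin n → ℚ) k → Σℚ (λ i → f i ℚ.- k ℚ.* g i) ≡ Σℚ f ℚ.- k ℚ.* Σℚ g
Σℚ-linear {zero}  f g k = sym (trans (cong (ℚ._-_ 0ℚ) (ℚP.*-zeroʳ k)) (ℚP.+-inverseʳ 0ℚ))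
Σℚ-linear {suc n} f g k = trans (cong (f zero ℚ.- k ℚ.* g zero ℚ.+_) (Σℚ-linear (λ i → f (suc i)) (λ i → g (suc i)) k))
                                (regroup (f zero) (g zero) _ _ k)
  where
  open +-*-Solver
  regroup : ∀ a b c d k → (a ℚ.- k ℚ.* b) ℚ.+ (c ℚ.- k ℚ.* d) ≡ (a ℚ.+ c) ℚ.- k ℚ.* (b ℚ.+ d)
  regroup = solve 5 (λ a b c d k → (a :- k :* b) :+ (c :- k :* d) := (a :+ c) :- k :* (b :+ d)) refl

e-suc : ∀ {n} (i j : Fin n) → e (suc i) (suc j) ≡ e i j
e-suc i j with i Fin.≟ j
... | yes _ = refl
... | no  _ = refl

Σℚ-e : ∀ {n} (c : Fin n → ℚ) j → Σℚ (λ i → c i ℚ.* toℚ (e i j)) ≡ c j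
Σℚ-e {suc n} c zero = begin
  c zero ℚ.* 1ℚ ℚ.+ Σℚ (λ i → c (suc i) ℚ.* 0ℚ)  ≡⟨ cong₂ ℚ._+_ (ℚP.*-identityʳ (c zero)) (Σℚ-cong (λ i → ℚP.*-zeroʳ (c (suc i)))) ⟩
  c zero ℚ.+ Σℚ {n} (λ _ → 0ℚ)                   ≡⟨ cong (c zero ℚ.+_) (Σℚ-zero n) ⟩
  c zero ℚ.+ 0ℚ                                  ≡⟨ ℚP.+-identityʳ (c zero) ⟩
  c zero                                         ∎
  where
  open ≡-Reasoning
  Σℚ-zero : ∀ n → Σℚ {n} (λ _ → 0ℚ) ≡ 0ℚ
  Σℚ-zero zero    = refl
  Σℚ-zero (suc n) = cong (0ℚ ℚ.+_) (Σℚ-zero n)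
Σℚ-e {suc n} c (suc j) = begin
  c zero ℚ.* 0ℚ ℚ.+ Σℚ (λ i → c (suc i) ℚ.* toℚ (e (suc i) (suc j)))  ≡⟨ cong₂ ℚ._+_ (ℚP.*-zeroʳ (c zero)) (Σℚ-cong (λ i → cong (λ z → c (suc i) ℚ.* toℚ z) (e-suc i j))) ⟩
  0ℚ ℚ.+ Σℚ (λ i → c (suc i) ℚ.* toℚ (e i j))                        ≡⟨ ℚP.+-identityˡ _ ⟩
  Σℚ (λ i → c (suc i) ℚ.* toℚ (e i j))                               ≡⟨ Σℚ-e (λ i → c (suc i)) j ⟩
  c (suc j)                                                          ∎
  where open ≡-Reasoning

-- The cone over Δ_(1,p)

Δ-combination : ∀ {N} (p : Fin N → ℕ) (c : Fin (suc N) → ℚ) j →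
                Σℚ (λ i → c i ℚ.* toℚ (Δ-vertices p i j)) ≡ c (suc j) ℚ.- c zero ℚ.* toℚ (+ p j)
Δ-combination p c j = begin
  c zero ℚ.* toℚ (- + p j) ℚ.+ Σℚ (λ i → c (suc i) ℚ.* toℚ (e i j))  ≡⟨ cong₂ (λ a b → c zero ℚ.* a ℚ.+ b) (toℚ-neg (+ p j)) (Σℚ-e (λ i → c (suc i)) j) ⟩
  c zero ℚ.* ℚ.- toℚ (+ p j) ℚ.+ c (suc j)                            ≡⟨ reorder (c zero) (toℚ (+ p j)) (c (suc j)) ⟩
  c (suc j) ℚ.- c zero ℚ.* toℚ (+ p j)                                ∎
  where
  open ≡-Reasoning
  open +-*-Solver
  reorder : ∀ a b c → a ℚ.* ℚ.- b ℚ.+ c ≡ c ℚ.- a ℚ.* b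
  reorder = solve 3 (λ a b c → a :* (:- b) :+ c := c :- a :* b) refl

-- vol p = 1 + Σ p is the normalised volume of Δ_(1,p).  For a point (m , w) of the cone,
-- vol p times its barycentric coordinates with respect to the vertices (1 , -p) and
-- (1 , e_j) are apexWeight m w and vertexWeight p m w j.

vol : ∀ {N} → (Fin N → ℕ) → ℕ
vol p = suc (Σℕ p)

apexWeight : ∀ {N} → ℤ → Point N → ℤ
apexWeight m w = m - Σℤ w

vertexWeight : ∀ {N} → (Fin N → ℕ) → ℤ → Point N → Fin N → ℤ
vertexWeight p m w j = + vol p * w j + apexWeight m w * + p j

weights-sum : ∀ {N} (p : Fin N → ℕ) m (w : Point N) →
              apexWeight m w + Σℤ (vertexWeight p m w) ≡ + vol p * m
weights-sum p m w = begin
  t + Σℤ (λ j → + vol p * w j + t * + p j)                ≡⟨ cong (_+_ t) (Σℤ-+ (λ j → + vol p * w j) (λ j → t * + p j)) ⟩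
  t + (Σℤ (λ j → + vol p * w j) + Σℤ (λ j → t * + p j))   ≡⟨ cong₂ (λ a b → t + (a + b)) (Σℤ-*ˡ (+ vol p) w) (Σℤ-*ˡ t (λ j → + p j)) ⟩
  t + (+ vol p * Σℤ w + t * Σℤ (λ j → + p j))             ≡⟨ cong (λ P → t + (+ vol p * Σℤ w + t * P)) (Σℤ-+ℕ p) ⟩
  t + (+ vol p * Σℤ w + t * + Σℕ p)                       ≡⟨ identity m (Σℤ w) (+ Σℕ p) ⟩
  + vol p * m                                             ∎
  where
  open ≡-Reasoning
  t = apexWeight m w
  identity : ∀ m W P → (m - W) + ((+ 1 + P) * W + (m - W) * P) ≡ (+ 1 + P) * m
  identity = solve-∀

toℚ-Σℕ : ∀ {N} (p : Fin N → ℕ) → Σℚ (λ j → toℚ (+ p j)) ≡ toℚ (+ Σℕ p)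
toℚ-Σℕ p = trans (Σℚ-toℚ (λ j → + p j)) (cong toℚ (Σℤ-+ℕ p))

InCone-Δ⇒weights-nonNeg : ∀ {N} (p : Fin N → ℕ) m (w : Point N) → InCone (Δ-vertices p) m w →
                          + 0 ℤ.≤ apexWeight m w × (∀ j → + 0 ℤ.≤ vertexWeight p m w j)
InCone-Δ⇒weights-nonNeg {N} p m w (c , 0≤c , Σc≡m , c-combines) =
  toℚ-nonNeg⁻¹ (subst (0ℚ ℚ.≤_) (sym apex) (*-nonNeg (0≤c zero) 0≤S)) ,
  λ j → toℚ-nonNeg⁻¹ (subst (0ℚ ℚ.≤_) (sym (vertex j)) (*-nonNeg 0≤S (0≤c (suc j))))
  where
  open ≡-Reasoning
  S = toℚ (+ vol p)
  X = toℚ (+ Σℕ p)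
  P : Fin N → ℚ
  P j = toℚ (+ p j)
  C = Σℚ (λ j → c (suc j))

  0≤S : 0ℚ ℚ.≤ S
  0≤S = toℚ-nonNeg {+ vol p} (ℤ.+≤+ ℕ.z≤n)

  w-coord : ∀ j → toℚ (w j) ≡ c (suc j) ℚ.- c zero ℚ.* P j
  w-coord j = trans (sym (c-combines j)) (Δ-combination p c j)

  apex : toℚ (apexWeight m w) ≡ c zero ℚ.* S
  apex = begin
    toℚ (m - Σℤ w)                             ≡⟨ toℚ-- m (Σℤ w) ⟩
    toℚ m ℚ.- toℚ (Σℤ w)                       ≡⟨ cong₂ ℚ._-_ (sym Σc≡m) (sym (Σℚ-toℚ w)) ⟩
    (c zero ℚ.+ C) ℚ.- Σℚ (λ j → toℚ (w j))    ≡⟨ cong (ℚ._-_ (c zero ℚ.+ C)) (trans (Σℚ-cong w-coord) (Σℚ-linear _ P (c zero))) ⟩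
    (c zero ℚ.+ C) ℚ.- (C ℚ.- c zero ℚ.* Σℚ P) ≡⟨ cong (λ Y → (c zero ℚ.+ C) ℚ.- (C ℚ.- c zero ℚ.* Y)) (toℚ-Σℕ p) ⟩
    (c zero ℚ.+ C) ℚ.- (C ℚ.- c zero ℚ.* X)    ≡⟨ cancel (c zero) C X ⟩
    c zero ℚ.+ c zero ℚ.* X                    ≡⟨ cong (ℚ._+ c zero ℚ.* X) (ℚP.*-identityʳ (c zero)) ⟨
    c zero ℚ.* 1ℚ ℚ.+ c zero ℚ.* X             ≡⟨ ℚP.*-distribˡ-+ (c zero) 1ℚ X ⟨
    c zero ℚ.* (1ℚ ℚ.+ X)                      ≡⟨ cong (c zero ℚ.*_) (toℚ-+ (+ 1) (+ Σℕ p)) ⟨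
    c zero ℚ.* S                               ∎
    where
    open +-*-Solver
    cancel : ∀ a C X → (a ℚ.+ C) ℚ.- (C ℚ.- a ℚ.* X) ≡ a ℚ.+ a ℚ.* X
    cancel = solve 3 (λ a C X → (a :+ C) :- (C :- a :* X) := a :+ a :* X) refl

  vertex : ∀ j → toℚ (vertexWeight p m w j) ≡ S ℚ.* c (suc j)
  vertex j = begin
    toℚ (+ vol p * w j + apexWeight m w * + p j)              ≡⟨ toℚ-+ (+ vol p * w j) _ ⟩
    toℚ (+ vol p * w j) ℚ.+ toℚ (apexWeight m w * + p j)      ≡⟨ cong₂ ℚ._+_ (toℚ-* (+ vol p) (w j)) (toℚ-* (apexWeight m w) (+ p j)) ⟩
    S ℚ.* toℚ (w j) ℚ.+ toℚ (apexWeight m w) ℚ.* P j          ≡⟨ cong₂ (λ a b → S ℚ.* a ℚ.+ b ℚ.* P j) (w-coord j) apex ⟩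
    S ℚ.* (c (suc j) ℚ.- c zero ℚ.* P j) ℚ.+ c zero ℚ.* S ℚ.* P j  ≡⟨ cancel S (c (suc j)) (c zero) (P j) ⟩
    S ℚ.* c (suc j)                                           ∎
    where
    open +-*-Solver
    cancel : ∀ S a b P → S ℚ.* (a ℚ.- b ℚ.* P) ℚ.+ b ℚ.* S ℚ.* P ≡ S ℚ.* a
    cancel = solve 4 (λ S a b P → S :* (a :- b :* P) :+ b :* S :* P := S :* a) refl

weights-nonNeg⇒InCone-Δ : ∀ {N} (p : Fin N → ℕ) m (w : Point N) →
                          + 0 ℤ.≤ apexWeight m w → (∀ j → + 0 ℤ.≤ vertexWeight p m w j) →
                          InCone (Δ-vertices p) m w
weights-nonNeg⇒InCone-Δ {N} p m w 0≤t 0≤y = c , 0≤c , Σc≡m , c-combines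
  where
  open ≡-Reasoning
  t = apexWeight m w
  y = vertexWeight p m w
  S = toℚ (+ vol p)

  instance
    S-positive : ℚ.Positive S
    S-positive = ℚP.normalize-pos (vol p) 1
    S-nonZero : ℚ.NonZero S
    S-nonZero = ℚP.pos⇒nonZero S

  u = ℚ.1/ S

  0≤u : 0ℚ ℚ.≤ u
  0≤u = ℚP.nonNegative⁻¹ u {{ℚP.pos⇒nonNeg u {{ℚP.1/pos⇒pos S}}}}

  unscale : ∀ z → toℚ (+ vol p * z) ℚ.* u ≡ toℚ z
  unscale z = begin
    toℚ (+ vol p * z) ℚ.* u    ≡⟨ cong (ℚ._* u) (toℚ-* (+ vol p) z) ⟩
    S ℚ.* toℚ z ℚ.* u          ≡⟨ swap S (toℚ z) u ⟩
    toℚ z ℚ.* (S ℚ.* u)        ≡⟨ cong (toℚ z ℚ.*_) (ℚP.*-inverseʳ S) ⟩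
    toℚ z ℚ.* 1ℚ               ≡⟨ ℚP.*-identityʳ (toℚ z) ⟩
    toℚ z                      ∎
    where
    open +-*-Solver
    swap : ∀ a b c → a ℚ.* b ℚ.* c ≡ b ℚ.* (a ℚ.* c)
    swap = solve 3 (λ a b c → a :* b :* c := b :* (a :* c)) refl

  c : Fin (suc N) → ℚ
  c zero    = toℚ t ℚ.* u
  c (suc j) = toℚ (y j) ℚ.* u

  0≤c : ∀ i → 0ℚ ℚ.≤ c i
  0≤c zero    = *-nonNeg (toℚ-nonNeg 0≤t) 0≤u
  0≤c (suc j) = *-nonNeg (toℚ-nonNeg (0≤y j)) 0≤u

  Σc≡m : Σℚ c ≡ toℚ m
  Σc≡m = begin
    toℚ t ℚ.* u ℚ.+ Σℚ (λ j → toℚ (y j) ℚ.* u)  ≡⟨ cong (toℚ t ℚ.* u ℚ.+_) (trans (Σℚ-*ʳ (λ j → toℚ (y j)) u) (cong (ℚ._* u) (Σℚ-toℚ y))) ⟩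
    toℚ t ℚ.* u ℚ.+ toℚ (Σℤ y) ℚ.* u            ≡⟨ ℚP.*-distribʳ-+ u (toℚ t) (toℚ (Σℤ y)) ⟨
    (toℚ t ℚ.+ toℚ (Σℤ y)) ℚ.* u                ≡⟨ cong (ℚ._* u) (toℚ-+ t (Σℤ y)) ⟨
    toℚ (t + Σℤ y) ℚ.* u                        ≡⟨ cong (λ z → toℚ z ℚ.* u) (weights-sum p m w) ⟩
    toℚ (+ vol p * m) ℚ.* u                     ≡⟨ unscale m ⟩
    toℚ m                                       ∎

  c-combines : ∀ j → Σℚ (λ i → c i ℚ.* toℚ (Δ-vertices p i j)) ≡ toℚ (w j)
  c-combines j = begin
    Σℚ (λ i → c i ℚ.* toℚ (Δ-vertices p i j))               ≡⟨ Δ-combination p c j ⟩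
    toℚ (y j) ℚ.* u ℚ.- toℚ t ℚ.* u ℚ.* toℚ (+ p j)          ≡⟨ factor (toℚ (y j)) (toℚ t) (toℚ (+ p j)) u ⟩
    (toℚ (y j) ℚ.- toℚ t ℚ.* toℚ (+ p j)) ℚ.* u              ≡⟨ cong (ℚ._* u) (trans (toℚ-- (y j) _) (cong (ℚ._-_ (toℚ (y j))) (toℚ-* t (+ p j)))) ⟨
    toℚ (y j - t * + p j) ℚ.* u                              ≡⟨ cong (λ z → toℚ z ℚ.* u) (cancel (+ vol p * w j) (t * + p j)) ⟩
    toℚ (+ vol p * w j) ℚ.* u                                ≡⟨ unscale (w j) ⟩
    toℚ (w j)                                                ∎
    where
    open +-*-Solver
    factor : ∀ a b P u → a ℚ.* u ℚ.- b ℚ.* u ℚ.* P ≡ (a ℚ.- b ℚ.* P) ℚ.* u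
    factor = solve 4 (λ a b P u → a :* u :- b :* u :* P := (a :- b :* P) :* u) refl
    cancel : ∀ a b → a + b - b ≡ a
    cancel = solve-∀

coneWitness : ∀ {N} → (Fin N → ℕ) → Point N
coneWitness p j = + 1 - + p j

apexWeight-coneWitness : ∀ {N} (p : Fin N → ℕ) → apexWeight (+ N) (coneWitness p) ≡ + Σℕ p
apexWeight-coneWitness {N} p = begin
  + N - Σℤ (λ j → + 1 - + p j)                 ≡⟨ cong (_-_ (+ N)) (Σℤ-- (λ _ → + 1) (λ j → + p j)) ⟩
  + N - (Σℤ {N} (λ _ → + 1) - Σℤ (λ j → + p j)) ≡⟨ cong₂ (λ a b → + N - (a - b)) (trans (Σℤ-const {N} (+ 1)) (ℤP.*-identityʳ (+ N))) (Σℤ-+ℕ p) ⟩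
  + N - (+ N - + Σℕ p)                         ≡⟨ cancel (+ N) (+ Σℕ p) ⟩
  + Σℕ p                                       ∎
  where
  open ≡-Reasoning
  cancel : ∀ a b → a - (a - b) ≡ b
  cancel = solve-∀

coneWitness∈cone : ∀ {N} (p : Fin N → ℕ) → InCone (Δ-vertices p) (+ N) (coneWitness p)
coneWitness∈cone {N} p = weights-nonNeg⇒InCone-Δ p (+ N) (coneWitness p) 0≤t 0≤y
  where
  t≡Σp = apexWeight-coneWitness p

  0≤t : + 0 ℤ.≤ apexWeight (+ N) (coneWitness p)
  0≤t = subst (+ 0 ℤ.≤_) (sym t≡Σp) (ℤ.+≤+ ℕ.z≤n)

  p≤Σp : ∀ j → + p j ℤ.≤ + Σℕ p
  p≤Σp j = subst (+ p j ℤ.≤_) (Σℤ-+ℕ p) (≤-Σℤ (λ _ → ℤ.+≤+ ℕ.z≤n) j)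

  0≤y : ∀ j → + 0 ℤ.≤ vertexWeight p (+ N) (coneWitness p) j
  0≤y j = subst (+ 0 ℤ.≤_) (sym y≡) (ℤP.i≤j⇒0≤j-i (ℤP.i≤j⇒i≤1+j (p≤Σp j)))
    where
    expand : ∀ P a → (+ 1 + P) * (+ 1 - a) + P * a ≡ (+ 1 + P) - a
    expand = solve-∀
    y≡ : vertexWeight p (+ N) (coneWitness p) j ≡ + vol p - + p j
    y≡ = trans (cong (λ T → + vol p * (+ 1 - + p j) + T * + p j) t≡Σp) (expand (+ Σℕ p) (+ p j))

-- Lattice points of Δ_(1,(1^K,q)) for K ≥ max q

0≤n*z+r⇒r<n⇒0≤z : ∀ n {z r} → + 0 ℤ.≤ + n * z + r → r ℤ.< + n → + 0 ℤ.≤ z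
0≤n*z+r⇒r<n⇒0≤z n {+ _}          _      _   = ℤ.+≤+ ℕ.z≤n
0≤n*z+r⇒r<n⇒0≤z n { -[1+ k ]} {r} 0≤nz+r r<n = ⊥-elim (ℤP.<⇒≱ nz+r<0 0≤nz+r)
  where
  open ℤP.≤-Reasoning
  nz+r<0 : + n * -[1+ k ] + r ℤ.< + 0
  nz+r<0 = begin-strict
    + n * -[1+ k ] + r     <⟨ ℤP.+-mono-≤-< (ℤP.*-monoˡ-≤-nonNeg (+ n) (ℤ.-≤- ℕ.z≤n)) r<n ⟩
    + n * -[1+ 0 ] + + n   ≡⟨ cong (_+ + n) (trans (ℤP.*-comm (+ n) -[1+ 0 ]) (ℤP.-1*i≡-i (+ n))) ⟩
    - + n + + n            ≡⟨ ℤP.+-inverseˡ (+ n) ⟩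
    + 0                    ∎

k≤K⇒k*t<n : ∀ {k K t n} → k ≤ K → + 0 ℤ.≤ t → t ℤ.< n → t + + K * t ℤ.≤ n → + k * t ℤ.< n
k≤K⇒k*t<n {k} {t = + zero}  _   _ t<n _ = subst (ℤ._< _) (sym (ℤP.*-zeroʳ (+ k))) t<n
k≤K⇒k*t<n {k} {K} {t@(+ suc _)} {n} k≤K _ _ t+Kt≤n = begin-strict
  + k * t           ≤⟨ ℤP.*-monoʳ-≤-nonNeg t (ℤ.+≤+ k≤K) ⟩
  + K * t           ≡⟨ ℤP.+-identityˡ (+ K * t) ⟨
  + 0 + + K * t     <⟨ ℤP.+-monoˡ-< (+ K * t) (ℤ.+<+ ℕ.z<s) ⟩
  t + + K * t       ≤⟨ t+Kt≤n ⟩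
  n                 ∎
  where open ℤP.≤-Reasoning

-- The vertex weight vol·x_j + t of a 1-coordinate forces x_j ≥ 0, so it is at least t;
-- hence t + K·t ≤ vol, which bounds the term q_i·t in the weight vol·x_j + q_i·t.
nonApex-nonNeg : ∀ {K n} (q : Fin n → ℕ) → (∀ i → q i ≤ K) → ∀ {x} →
                 InConv (Δ-vertices (ones++ K q)) x → apexWeight (+ 1) x ℤ.< + vol (ones++ K q) →
                 ∀ i → + 0 ℤ.≤ x (K ↑ʳ i)
nonApex-nonNeg {K} {n} q q≤K {x} x∈Δ t<s i =
  0≤n*z+r⇒r<n⇒0≤z s (subst (+ 0 ℤ.≤_) (y-q i) (0≤y (K ↑ʳ i))) (k≤K⇒k*t<n (q≤K i) 0≤t t<s t+Kt≤s)
  where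
  p = ones++ K q
  s = vol p
  t = apexWeight (+ 1) x
  y = vertexWeight p (+ 1) x

  0≤t : + 0 ℤ.≤ t
  0≤t = proj₁ (InCone-Δ⇒weights-nonNeg p (+ 1) x x∈Δ)

  0≤y : ∀ j → + 0 ℤ.≤ y j
  0≤y = proj₂ (InCone-Δ⇒weights-nonNeg p (+ 1) x x∈Δ)

  y-one : ∀ i → y (i ↑ˡ n) ≡ + s * x (i ↑ˡ n) + t
  y-one i = cong (_+_ (+ s * x (i ↑ˡ n)))
                 (trans (cong (λ a → t * + a) (lookup-++ˡ (replicate K 1) q i)) (ℤP.*-identityʳ t))

  y-q : ∀ i → y (K ↑ʳ i) ≡ + s * x (K ↑ʳ i) + + q i * t
  y-q i = cong (_+_ (+ s * x (K ↑ʳ i)))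
               (trans (cong (λ a → t * + a) (lookup-++ʳ (replicate K 1) q i)) (ℤP.*-comm t (+ q i)))

  t≤y-one : ∀ i → t ℤ.≤ y (i ↑ˡ n)
  t≤y-one i = subst (t ℤ.≤_) (sym (y-one i)) (ℤP.i≤j+i t (+ s * x (i ↑ˡ n)) {{ℤ.nonNegative 0≤sx}})
    where
    0≤x : + 0 ℤ.≤ x (i ↑ˡ n)
    0≤x = 0≤n*z+r⇒r<n⇒0≤z s (subst (+ 0 ℤ.≤_) (y-one i) (0≤y (i ↑ˡ n))) t<s
    0≤sx : + 0 ℤ.≤ + s * x (i ↑ˡ n)
    0≤sx = subst (ℤ._≤ + s * x (i ↑ˡ n)) (ℤP.*-zeroʳ (+ s)) (ℤP.*-monoˡ-≤-nonNeg (+ s) 0≤x)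

  t+Kt≤s : t + + K * t ℤ.≤ + s
  t+Kt≤s = begin
    t + + K * t                                            ≡⟨ cong (_+_ t) (Σℤ-const {K} t) ⟨
    t + Σℤ {K} (λ _ → t)                                   ≤⟨ ℤP.+-monoʳ-≤ t (Σℤ-mono-≤ t≤y-one) ⟩
    t + Σℤ (λ i → y (i ↑ˡ n))                              ≤⟨ ℤP.+-monoʳ-≤ t (ℤP.i≤i+j _ _ {{ℤ.nonNegative 0≤Σy-q}}) ⟩
    t + (Σℤ (λ i → y (i ↑ˡ n)) + Σℤ (λ i → y (K ↑ʳ i)))    ≡⟨ cong (_+_ t) (Σℤ-↑ K y) ⟨
    t + Σℤ y                                               ≡⟨ weights-sum p (+ 1) x ⟩
    + s * + 1                                              ≡⟨ ℤP.*-identityʳ (+ s) ⟩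
    + s                                                    ∎
    where
    open ℤP.≤-Reasoning
    0≤Σy-q : + 0 ℤ.≤ Σℤ (λ i → y (K ↑ʳ i))
    0≤Σy-q = Σℤ-nonNeg (λ i → 0≤y (K ↑ʳ i))

1-q<0 : ∀ {q} → 2 ≤ q → + 1 - + q ℤ.< + 0
1-q<0 (ℕ.s≤s (ℕ.s≤s _)) = ℤ.-<+

module _ {K n : ℕ} (q : Fin n → ℕ) (q≤K : ∀ i → q i ≤ K) where

  private
    p = ones++ K q
    N = K ℕ.+ n

  coneWitness-indecomposable : ∀ j₀ → 2 ≤ q j₀ → (xs : Fin N → Point N) →
                               (∀ i → InConv (Δ-vertices p) (xs i)) →
                               ¬ (∀ j → Σℤ (λ i → xs i j) ≡ coneWitness p j)
  coneWitness-indecomposable j₀ 2≤q xs xs∈Δ Σxs≡w = ℤP.<⇒≱ w-j₀<0 0≤w-j₀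
    where
    t : Fin N → ℤ
    t i = apexWeight (+ 1) (xs i)

    Σt≡Σp : Σℤ t ≡ + Σℕ p
    Σt≡Σp = begin
      Σℤ (λ i → + 1 - Σℤ (xs i))                   ≡⟨ Σℤ-- (λ _ → + 1) (λ i → Σℤ (xs i)) ⟩
      Σℤ {N} (λ _ → + 1) - Σℤ (λ i → Σℤ (xs i))    ≡⟨ cong₂ _-_ (trans (Σℤ-const {N} (+ 1)) (ℤP.*-identityʳ (+ N))) (trans (Σℤ-comm xs) (Σℤ-cong Σxs≡w)) ⟩
      apexWeight (+ N) (coneWitness p)             ≡⟨ apexWeight-coneWitness p ⟩
      + Σℕ p                                       ∎
      where open ≡-Reasoning

    t<vol : ∀ i → t i ℤ.< + vol p
    t<vol i = ℤP.≤-<-trans (subst (t i ℤ.≤_) Σt≡Σp (≤-Σℤ 0≤t i)) (ℤ.+<+ (ℕP.n<1+n _))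
      where
      0≤t : ∀ i → + 0 ℤ.≤ t i
      0≤t i = proj₁ (InCone-Δ⇒weights-nonNeg p (+ 1) (xs i) (xs∈Δ i))

    0≤w-j₀ : + 0 ℤ.≤ coneWitness p (K ↑ʳ j₀)
    0≤w-j₀ = subst (+ 0 ℤ.≤_) (Σxs≡w (K ↑ʳ j₀))
                   (Σℤ-nonNeg (λ i → nonApex-nonNeg q q≤K (xs∈Δ i) (t<vol i) j₀))

    w-j₀<0 : coneWitness p (K ↑ʳ j₀) ℤ.< + 0
    w-j₀<0 = subst (λ a → + 1 - + a ℤ.< + 0) (sym (lookup-++ʳ (replicate K 1) q j₀)) (1-q<0 2≤q)

  ¬IDP-Δ : ∀ j₀ → 2 ≤ q j₀ → ¬ IDP (Δ-vertices (ones++ K q))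
  ¬IDP-Δ j₀ 2≤q idp =
    let xs , xs∈Δ , Σxs≡w = idp N 1≤N (coneWitness p) (coneWitness∈cone p)
    in  coneWitness-indecomposable j₀ 2≤q xs xs∈Δ Σxs≡w
    where
    1≤N : 1 ≤ N
    1≤N = ℕ.>-nonZero⁻¹ N {{FinP.nonZeroIndex (K ↑ʳ j₀)}}

lcm-nonZero : ∀ m n → {{NonZero m}} → {{NonZero n}} → NonZero (lcm m n)
lcm-nonZero m n = ℕP.m*n≢0⇒n≢0 (gcd m n) {{subst NonZero (sym (gcd*lcm m n)) (ℕP.m*n≢0 m n)}}

lcmV-nonZero : ∀ {n} (q : Fin n → ℕ) → (∀ i → NonZero (q i)) → NonZero (lcmV q)
lcmV-nonZero {zero}  q q≢0 = _
lcmV-nonZero {suc n} q q≢0 =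
  lcm-nonZero (q zero) _ {{q≢0 zero}} {{lcmV-nonZero (λ i → q (suc i)) (λ i → q≢0 (suc i))}}

∣lcmV : ∀ {n} (q : Fin n → ℕ) i → q i ∣ lcmV q
∣lcmV q zero    = m∣lcm[m,n] (q zero) _
∣lcmV q (suc i) = ∣-trans (∣lcmV (λ j → q (suc j)) i) (n∣lcm[m,n] (q zero) _)

≤lcmV : ∀ {n} (q : Fin n → ℕ) → (∀ i → NonZero (q i)) → ∀ i → q i ≤ lcmV q
≤lcmV q q≢0 i = ∣⇒≤ {{lcmV-nonZero q q≢0}} (∣lcmV q i)

theorem5p4 : (n : ℕ) → 1 ≤ n → (q : Fin n → ℕ) → (∀ i → 2 ≤ q i) → WeaklyIncreasing q →
    (k : ℕ) → IsRsn q k → (m : ℕ) → 2 ≤ m → ¬ IDP (Δ-vertices (rs q k m))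
theorem5p4 zero    () _ _ _ _ _ _ _
theorem5p4 (suc n) _  _ _ _ _ _ zero          ()
theorem5p4 (suc n) _  _ _ _ _ _ (suc zero)    (ℕ.s≤s ())
theorem5p4 (suc n) _  q 2≤q _ k _ m@(suc (suc _)) _ =
  ¬IDP-Δ {K = k ℕ.+ (m ∸ 1) ℕ.* lcmV q} q q≤K zero (2≤q zero)
  where
  q≢0 : ∀ i → NonZero (q i)
  q≢0 i = ℕ.>-nonZero (ℕP.<-≤-trans ℕ.z<s (2≤q i))
  q≤K : ∀ i → q i ≤ k ℕ.+ (m ∸ 1) ℕ.* lcmV q
  q≤K i = ℕP.≤-trans (≤lcmV q q≢0 i) (ℕP.≤-trans (ℕP.m≤n*m (lcmV q) (m ∸ 1)) (ℕP.m≤n+m _ k))
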